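{- Let $G$ be a directed graph on vertex set $V$ and let $E^+\subseteq V\times V$ be a set of at most $f$ edges. Let $H$ be a graph on $V$ with $O(nf)$ edges containing the following edges: (1) for each strongly connected component $S$ of $G$, a directed cycle on the vertices of $S$; (2) for each $uv\in E^+$ and each $w\in V$, an edge $vw$ if $v$ can reach $w$ in $G\cup E^+$, and an edge $wv$ if $w$ can reach $v$ in $G\cup E^+$. Then for all $u,v\in V$, $u$ and $v$ are strongly connected in $G\cup E^+$ if and only if they are strongly connected in $H$.
   Context: $G\cup E^+$ denotes the graph $(V,E(G)\cup E^+)$. -}

module Defs where

open import Level using (Level; _⊔_) renaming (suc to lsuc)
open import Data.Nat using (ℕ)
open import Data.Fin using (Fin)
open import Data.Product using (_×_; _,_; ∃; ∃-syntax)
open import Data.Sum using (_⊎_)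
open import Data.List using (List; []; _∷_; _++_)
open import Data.List.Membership.Propositional using (_∈_)
open import Data.List.Relation.Unary.Unique.Propositional using (Unique)
open import Relation.Binary.PropositionalEquality using (_≡_)
open import Relation.Binary.Construct.Closure.ReflexiveTransitive using (Star)

Graph : ℕ → Set₁
Graph n = Fin n → Fin n → Set

Reach : ∀ {n} → Graph n → Fin n → Fin n → Set
Reach E = Star E

StronglyConnected : ∀ {n} → Graph n → Fin n → Fin n → Set
StronglyConnected E u v = Reach E u v × Reach E v u

_∪E_ : ∀ {n} → Graph n → List (Fin n × Fin n) → Graph n
(G ∪E Eplus) x y = G x y ⊎ ((x , y) ∈ Eplus)

-- Edges of the directed cycle given by a list c₀ c₁ … cₖ (k ≥ 1):
-- cᵢ → cᵢ₊₁ and the closing edge cₖ → c₀. A one-vertex list gives no edges.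
data CycleEdge {n} : List (Fin n) → Fin n → Fin n → Set where
  step  : ∀ as x y bs → CycleEdge (as ++ x ∷ y ∷ bs) x y
  close : ∀ x mid y → CycleEdge (y ∷ mid ++ x ∷ []) x y

-- A choice of directed cycle for every strongly connected component of G:
-- cyc x lists the vertices of the SCC of x without repetition (in cycle order),
-- and vertices of the same SCC get the same cycle.
record SCCCycles {n} (G : Graph n) (cyc : Fin n → List (Fin n)) : Set where
  field
    noDup     : ∀ x → Unique (cyc x)
    members   : ∀ x y → (y ∈ cyc x → StronglyConnected G x y)
                      × (StronglyConnected G x y → y ∈ cyc x)
    sameCycle : ∀ x y → StronglyConnected G x y → cyc x ≡ cyc y

data HEdge {n} (G : Graph n) (Eplus : List (Fin n × Fin n))
           (cyc : Fin n → List (Fin n)) : Fin n → Fin n → Set where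
  cycleEdge : ∀ {x y} z → CycleEdge (cyc z) x y → HEdge G Eplus cyc x y
  outEdge   : ∀ {u v w} → (u , v) ∈ Eplus → Reach (G ∪E Eplus) v w
            → HEdge G Eplus cyc v w
  inEdge    : ∀ {u v w} → (u , v) ∈ Eplus → Reach (G ∪E Eplus) w v
            → HEdge G Eplus cyc w v

{-# OPTIONS --safe #-}
-- If some path between u and v
-- uses a new edge ab, then u and v both reach and are reached from b in G ∪ E⁺, so H
-- has the edges u → b, b → v (and back) by construction. Otherwise u and v are
-- strongly connected in G itself, hence lie on the cycle of their SCC, which is in H.
-- Conversely every edge of H is a path of G ∪ E⁺: cycle edges join vertices of one
-- SCC of G, and the other edges are reachability witnesses by definition.
module Submission where

open import Defs
open import Data.Nat using (ℕ; _≤_)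
open import Data.Fin using (Fin)
open import Data.Product using (_×_; _,_; proj₁; proj₂; swap; ∃-syntax)
open import Data.Sum using (_⊎_; inj₁; inj₂)
open import Data.List using (List; length; []; _∷_; _++_; [_]; InitLast; initLast; _∷ʳ′_)
open import Data.List.Properties using (++-assoc)
open import Data.List.Membership.Propositional using (_∈_)
open import Data.List.Membership.Propositional.Properties using (∈-∃++; ∈-++⁺ʳ; ∈-++⁻)
open import Data.List.Relation.Unary.Any using (here; there)
open import Relation.Binary.PropositionalEquality using (refl; sym; cong; subst)
open import Relation.Binary.Construct.Closure.ReflexiveTransitive
  using (Star; ε; _◅_; _◅◅_; map; concat)

module _ {n : ℕ} where

  private
    V : Set
    V = Fin n

  cycleEdge-∈ : ∀ {c : List V} {x y} → CycleEdge c x y → x ∈ c × y ∈ c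
  cycleEdge-∈ (step as x y bs) = ∈-++⁺ʳ as (here refl) , ∈-++⁺ʳ as (there (here refl))
  cycleEdge-∈ (close x mid y)  = there (∈-++⁺ʳ mid (here refl)) , here refl

  cycle-forward : ∀ (as : List V) x ds {y} → y ∈ ds → Star (CycleEdge (as ++ x ∷ ds)) x y
  cycle-forward as x (d ∷ ds) (here refl) = step as x d ds ◅ ε
  cycle-forward as x (d ∷ ds) (there y∈ds) =
    step as x d ds ◅ subst (λ c → Star (CycleEdge c) d _) (++-assoc as [ x ] (d ∷ ds))
                           (cycle-forward (as ++ [ x ]) d ds y∈ds)

  cycle-fromHead : ∀ h t {y} → y ∈ h ∷ t → Star (CycleEdge (h ∷ t)) h y
  cycle-fromHead h t (here refl)  = ε
  cycle-fromHead h t (there y∈t) = cycle-forward [] h t y∈t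

  cycle-toLast : ∀ h as x ds l → Star (CycleEdge (h ∷ (as ++ x ∷ ds) ++ [ l ])) x l
  cycle-toLast h as x ds l =
    subst (λ c → Star (CycleEdge c) x l) (cong (h ∷_) (sym (++-assoc as (x ∷ ds) [ l ])))
          (cycle-forward (h ∷ as) x (ds ++ [ l ]) (∈-++⁺ʳ ds (here refl)))

  cycle-toHead : ∀ h t {x} → x ∈ h ∷ t → Star (CycleEdge (h ∷ t)) x h
  cycle-toHead h t (here refl) = ε
  cycle-toHead h t (there x∈t) = toHead (initLast t) x∈t
    where
    toHead : ∀ {t} → InitLast t → ∀ {x} → x ∈ t → Star (CycleEdge (h ∷ t)) x h
    toHead (m ∷ʳ′ l) x∈ml with ∈-++⁻ m x∈ml
    ... | inj₂ (here refl) = close l m h ◅ ε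
    ... | inj₁ x∈m with ∈-∃++ x∈m
    ...   | as , ds , refl = cycle-toLast h as _ ds l ◅◅ (close l (as ++ _ ∷ ds) h ◅ ε)

  cycle-reach : ∀ c {x y} → x ∈ c → y ∈ c → Star (CycleEdge c) x y
  cycle-reach (h ∷ t) x∈c y∈c = cycle-toHead h t x∈c ◅◅ cycle-fromHead h t y∈c

  module _ (G : Graph n) (Eplus : List (V × V)) where

    Reach-old-or-viaNew : ∀ {x y} → Reach (G ∪E Eplus) x y →
      Reach G x y ⊎ ∃[ a ] ∃[ b ] ((a , b) ∈ Eplus × Reach (G ∪E Eplus) x b × Reach (G ∪E Eplus) b y)
    Reach-old-or-viaNew ε = inj₁ ε
    Reach-old-or-viaNew (inj₁ g ◅ p) with Reach-old-or-viaNew p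
    ... | inj₁ q                      = inj₁ (g ◅ q)
    ... | inj₂ (a , b , ab , xb , by) = inj₂ (a , b , ab , inj₁ g ◅ xb , by)
    Reach-old-or-viaNew (inj₂ ab ◅ p) = inj₂ (_ , _ , ab , inj₂ ab ◅ ε , p)

    module _ (cyc : V → List V) (cycles : SCCCycles G cyc) where
      open SCCCycles cycles

      private
        H : Graph n
        H = HEdge G Eplus cyc

      ReachH-viaNew : ∀ {a b x y} → (a , b) ∈ Eplus →
        Reach (G ∪E Eplus) x b → Reach (G ∪E Eplus) b y → Reach H x y
      ReachH-viaNew ab xb by = inEdge ab xb ◅ outEdge ab by ◅ ε

      StronglyConnectedH-viaNew : ∀ {x y} → StronglyConnected (G ∪E Eplus) x y →
        ∀ {a b} → (a , b) ∈ Eplus → Reach (G ∪E Eplus) x b → Reach (G ∪E Eplus) b y →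
        StronglyConnected H x y
      StronglyConnectedH-viaNew (xy , yx) ab xb by =
        ReachH-viaNew ab xb by , ReachH-viaNew ab (yx ◅◅ xb) (by ◅◅ yx)

      StronglyConnectedH-old : ∀ {x y} → StronglyConnected G x y → StronglyConnected H x y
      StronglyConnectedH-old {x} {y} sc =
        map (cycleEdge x) (cycle-reach (cyc x) x∈c y∈c) , map (cycleEdge x) (cycle-reach (cyc x) y∈c x∈c)
        where
        x∈c : x ∈ cyc x
        x∈c = proj₂ (members x x) (ε , ε)
        y∈c : y ∈ cyc x
        y∈c = proj₂ (members x y) sc

      StronglyConnected⇒StronglyConnectedH : ∀ {x y} →
        StronglyConnected (G ∪E Eplus) x y → StronglyConnected H x y
      StronglyConnected⇒StronglyConnectedH sc@(xy , yx)
        with Reach-old-or-viaNew xy | Reach-old-or-viaNew yx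
      ... | inj₂ (_ , _ , ab , xb , by) | _ = StronglyConnectedH-viaNew sc ab xb by
      ... | inj₁ _ | inj₂ (_ , _ , ab , yb , bx) = swap (StronglyConnectedH-viaNew (yx , xy) ab yb bx)
      ... | inj₁ gxy | inj₁ gyx = StronglyConnectedH-old (gxy , gyx)

      HEdge⇒Reach : ∀ {x y} → H x y → Reach (G ∪E Eplus) x y
      HEdge⇒Reach (cycleEdge {x} {y} z e) =
        map inj₁ (proj₂ (proj₁ (members z x) x∈c) ◅◅ proj₁ (proj₁ (members z y) y∈c))
        where
        x∈c : x ∈ cyc z
        x∈c = proj₁ (cycleEdge-∈ e)
        y∈c : y ∈ cyc z
        y∈c = proj₂ (cycleEdge-∈ e)
      HEdge⇒Reach (outEdge _ vw) = vw
      HEdge⇒Reach (inEdge _ wv)  = wv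

      ReachH⇒Reach : ∀ {x y} → Reach H x y → Reach (G ∪E Eplus) x y
      ReachH⇒Reach p = concat (map HEdge⇒Reach p)

lemma5p4 : (n f : ℕ) (G : Graph n) (Eplus : List (Fin n × Fin n))
           → length Eplus ≤ f
           → (cyc : Fin n → List (Fin n)) → SCCCycles G cyc
           → ∀ u v → (StronglyConnected (G ∪E Eplus) u v → StronglyConnected (HEdge G Eplus cyc) u v)
                   × (StronglyConnected (HEdge G Eplus cyc) u v → StronglyConnected (G ∪E Eplus) u v)
-- The bound on |E⁺| only controls the size of H; the equivalence holds for any E⁺.
lemma5p4 n f G Eplus _ cyc cycles u v =
  StronglyConnected⇒StronglyConnectedH G Eplus cyc cycles ,
  λ { (uv , vu) → ReachH⇒Reach G Eplus cyc cycles uv , ReachH⇒Reach G Eplus cyc cycles vu }
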